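{- Let $\mathcal{A}$ be a central hyperplane arrangement in a finite-dimensional real vector space $V$, and let $m,l$ be natural numbers. If a map $f\colon \mathbf{Ch}(\mathcal{A})^m \to \mathbf{Ch}(\mathcal{A})^l$ satisfies IIA, then $f$ (viewed as a map on vertex sets) is a simplicial map $\tilde f^{M}\colon M_m(\mathcal{A}) \to M_l(\mathcal{A})$.
   Context: A central hyperplane arrangement $\mathcal{A}$ in $V$ is a finite set of linear hyperplanes of $V$. A chamber of $\mathcal{A}$ is a connected component of $V\setminus\bigcup_{H\in\mathcal{A}}H$; $\mathbf{Ch}(\mathcal{A})$ is the set of chambers. For $H\in\mathcal{A}$, $\mathbf{Ch}(\{H\})$ consists of the two open half-spaces bounded by $H$, and $\epsilon_H\colon\mathbf{Ch}(\mathcal{A})\to\mathbf{Ch}(\{H\})$ sends a chamber to the half-space containing it; $\epsilon_H^k$ denotes the componentwise map $\mathbf{Ch}(\mathcal{A})^k\to\mathbf{Ch}(\{H\})^k$. A map $f\colon \mathbf{Ch}(\mathcal{A})^m\to\mathbf{Ch}(\mathcal{A})^l$ satisfies IIA if for every $H\in\mathcal{A}$ there is a map $\phi_H\colon\mathbf{Ch}(\{H\})^m\to\mathbf{Ch}(\{H\})^l$ with $\epsilon_H^l\circ f=\phi_H\circ\epsilon_H^m$. For $k\ge1$, $M_k(\mathcal{A})$ is the abstract simplicial complex with vertex set $\mathbf{Ch}(\mathcal{A})^k$ in which a nonempty finite subset $T\subseteq\mathbf{Ch}(\mathcal{A})^k$ is a simplex iff there exists $H\in\mathcal{A}$ which does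 not separate $T$, i.e. $|\epsilon_H^k(T)|\le 1$. -}

module Defs where

open import Level using (Level; _⊔_; suc)
open import Algebra.Bundles using (CommutativeRing)
open import Data.Nat using (ℕ)
open import Data.Fin using (Fin)
open import Data.Vec using (Vec; map)
open import Data.List using (List; [])
open import Data.List.Membership.Propositional using (_∈_)
open import Data.Product using (Σ; ∃; _×_; _,_)
open import Data.Sum using (_⊎_)
open import Relation.Binary.PropositionalEquality using (_≡_)
open import Relation.Nullary using (¬_)

-- Ordered fields (the real numbers are the intended instance; the
-- standard library has no reals, so we work over an arbitrary ordered
-- field, which contains ℝ as a special case).

record OrderedField (c ℓ : Level) : Set (suc (c ⊔ ℓ)) where
  field
    commRing : CommutativeRing c ℓ
  open CommutativeRing commRing public
  field
    _<_        : Carrier → Carrier → Set ℓ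
    <-irrefl   : ∀ {x} → ¬ (x < x)
    <-trans    : ∀ {x y z} → x < y → y < z → x < z
    <-resp-≈   : ∀ {x x' y y'} → x ≈ x' → y ≈ y' → x < y → x' < y'
    <-trichot  : ∀ x y → x < y ⊎ (x ≈ y ⊎ y < x)
    +-mono-<   : ∀ {x y} z → x < y → (x + z) < (y + z)
    *-pos      : ∀ {x y} → 0# < x → 0# < y → 0# < (x * y)
    0≉1        : ¬ (0# ≈ 1#)
    inverse    : ∀ x → ¬ (x ≈ 0#) → ∃ λ y → (x * y) ≈ 1#

module _ {c ℓ : Level} (K : OrderedField c ℓ) where
  open OrderedField K

  Vect : ℕ → Set c
  Vect n = Fin n → Carrier

  dot : ∀ {n} → Vect n → Vect n → Carrier
  dot {ℕ.zero}  a x = 0#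
  dot {ℕ.suc n} a x = (a Fin.zero * x Fin.zero) + dot (λ i → a (Fin.suc i)) (λ i → x (Fin.suc i))

  scale : ∀ {n} → Carrier → Vect n → Vect n
  scale c a i = c * a i

-- A linear hyperplane is the kernel of a nonzero linear form x ↦ a · x;
-- the arrangement has k distinct hyperplanes H_0,…,H_{k-1}, given by
-- chosen normal vectors (the choice of normal fixes which open half-space
-- of H is called "positive").

  record Arrangement (n k : ℕ) : Set (c ⊔ ℓ) where
    field
      normal   : Fin k → Vect n
      nonzero  : ∀ H → ∃ λ i → ¬ (normal H i ≈ 0#)
      distinct : ∀ H H' → ¬ (H ≡ H') →
                 ¬ (∃ λ t → ∀ i → normal H i ≈ (t * normal H' i))

-- The two open half-spaces bounded by a hyperplane H, i.e. Ch({H}):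
-- pos = {x | a_H · x > 0},  neg = {x | a_H · x < 0}.
data Side : Set where
  pos neg : Side

module _ {c ℓ : Level} (K : OrderedField c ℓ) {n k : ℕ} (𝒜 : Arrangement K n k) where
  open OrderedField K
  open Arrangement 𝒜

  InSide : Vect K n → Fin k → Side → Set ℓ
  InSide x H pos = 0# < dot K (normal H) x
  InSide x H neg = dot K (normal H) x < 0#

  -- Chambers: a chamber (connected component of the complement) is
  -- determined by, and identified with, the half-space of each H
  -- containing it; a sign vector is a chamber iff some point realises it.
  record Ch : Set (c ⊔ ℓ) where
    constructor chamber
    field
      sides      : Fin k → Side
      .realised  : ∃ λ (x : Vect K n) → ∀ H → InSide x H (sides H)
  open Ch public

  ε : Fin k → Ch → Side
  ε H C = sides C H

  εᵏ : ∀ {m} → Fin k → Vec Ch m → Vec Side m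
  εᵏ H = map (ε H)

  IIA : ∀ {m l} → (Vec Ch m → Vec Ch l) → Set (c ⊔ ℓ)
  IIA {m} {l} f = ∀ H → ∃ λ (φ : Vec Side m → Vec Side l) →
                  ∀ (v : Vec Ch m) → εᵏ H (f v) ≡ φ (εᵏ H v)

  NotSeparating : ∀ {m} → Fin k → List (Vec Ch m) → Set (c ⊔ ℓ)
  NotSeparating H T = ∀ {s t} → s ∈ T → t ∈ T → εᵏ H s ≡ εᵏ H t

  -- Simplices of M_m(𝒜): nonempty finite subsets T of Ch(𝒜)^m (given as
  -- a list of their elements) such that some H ∈ 𝒜 does not separate T.
  IsSimplex : ∀ m → List (Vec Ch m) → Set (c ⊔ ℓ)
  IsSimplex m T = ¬ (T ≡ []) × ∃ λ H → NotSeparating H T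

  IsSimplicial : ∀ {m l} → (Vec Ch m → Vec Ch l) → Set (c ⊔ ℓ)
  IsSimplicial {m} {l} f = ∀ (T : List (Vec Ch m)) → IsSimplex m T → IsSimplex l (Data.List.map f T)

{-# OPTIONS --safe #-}
module Submission where

open import Defs
open import Level using (Level; _⊔_)
open import Data.Nat using (ℕ)
open import Data.Vec using (Vec)
open import Data.List using (List; []; _∷_; map)
open import Data.List.Membership.Propositional using (_∈_)
open import Data.List.Membership.Propositional.Properties using (∈-map⁻)
open import Data.Product using (_,_)
open import Relation.Binary.PropositionalEquality using (_≡_; refl; cong; module ≡-Reasoning)
open import Relation.Nullary using (¬_)

private
  variable
    a b c d : Level
    A : Set a
    B : Set b
    C : Set c
    D : Set d

ConstantOn : {A : Set a} {B : Set b} → (A → B) → List A → Set (a ⊔ b)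
ConstantOn g T = ∀ {s t} → s ∈ T → t ∈ T → g s ≡ g t

map-≢[] : ∀ {f : A → B} {T : List A} → ¬ T ≡ [] → ¬ map f T ≡ []
map-≢[] {T = []}    T≢[] _ = T≢[] refl
map-≢[] {T = _ ∷ _} _    ()

constantOn-map : ∀ {f : A → B} {g : B → D} {h : A → C} {φ : C → D} →
                 (∀ x → g (f x) ≡ φ (h x)) →
                 ∀ {T} → ConstantOn h T → ConstantOn g (map f T)
constantOn-map {f = f} {g} {h} {φ} g∘f≗φ∘h h-const s∈fT t∈fT
  with ∈-map⁻ f s∈fT | ∈-map⁻ f t∈fT
... | s , s∈T , refl | t , t∈T , refl = begin
  g (f s)  ≡⟨ g∘f≗φ∘h s ⟩
  φ (h s)  ≡⟨ cong φ (h-const s∈T t∈T) ⟩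
  φ (h t)  ≡⟨ g∘f≗φ∘h t ⟨
  g (f t)  ∎
  where open ≡-Reasoning

-- NotSeparating H is ConstantOn (εᵏ H), and IIA at H factors εᵏ H ∘ f through εᵏ H.
mainTheorem1 : ∀ {c ℓ : Level} (K : OrderedField c ℓ) (n k : ℕ) (𝒜 : Arrangement K n k) (m l : ℕ)
                 (f : Vec (Ch K 𝒜) m → Vec (Ch K 𝒜) l) →
                 IIA K 𝒜 f → IsSimplicial K 𝒜 f
mainTheorem1 K n k 𝒜 m l f iia T (T≢[] , H , H-nonsep) with iia H
... | φ , εf≗φε = map-≢[] T≢[] , H , constantOn-map {φ = φ} εf≗φε H-nonsep
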